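{- Let $n\ge3$, $A\in\mathcal{PC}_n^0$, $\tau\in\Gamma(A)$ and $i,j\in N$ with $i\ne j$. Then $P_{A,\tau}(i,j)\ge1$ if and only if $w_i\ge w_j$ for all $w\in\mathcal{E}_\tau(A)$.
   Context: Let $N=\{1,\dots,n\}$. A matrix $A=[a_{ij}]$ is reciprocal if its entries are positive and $a_{ji}=1/a_{ij}$; $\mathcal{PC}_n$ is the set of $n\times n$ reciprocal matrices; $A$ is consistent if $a_{ij}a_{jk}=a_{ik}$ for all $i,j,k$; $\mathcal{PC}_n^0$ is the set of non-consistent matrices in $\mathcal{PC}_n$. $\mathbb{R}^n_+$ is the set of positive vectors. A Hamiltonian cycle (H-cycle) in $N$ is a cyclic sequence $\tau=\tau_1\cdots\tau_n\tau_1$ with $\tau_1\cdots\tau_n$ a permutation of $N$ (listable from any index). $\tau(A)=a_{\tau_1\tau_2}\cdots a_{\tau_{n-1}\tau_n}a_{\tau_n\tau_1}$; $\Gamma(A)$ is the set of H-cycles with $\tau(A)<1$. For $i\ne j$, listing $\tau$ with $\tau_1=i$ and $\tau_k=j$, $P_{A,\tau}(i,j)=a_{\tau_1\tau_2}\cdots a_{\tau_{k-1}\tau_k}$. For $\tau\in\Gamma(A)$ listed as $\tau_1\cdots\tau_n\tau_1$, $\mathcal{E}_\tau(A)=\{w\in\mathbb{R}^n_+: w_{\tau_1}\ge P_{A,\tau}(\tau_1,\tau_2)w_{\tau_2}\ge\cdots\ge P_{A,\tau}(\tau_1,\tau_n)w_{\tau_n}\ge \tau(A)w_{\tau_1}\}$.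 -}

module Defs where

open import Level using (0ℓ)
open import Data.Nat as ℕ using (ℕ; zero; suc; _∸_)
open import Data.Nat.DivMod using (_%_; _mod_)
open import Data.Fin using (Fin; toℕ) renaming (zero to fzero)
open import Data.Fin.Permutation using (Permutation′; _⟨$⟩ʳ_; _⟨$⟩ˡ_)
open import Data.Product using (Σ; _×_)
open import Data.Unit using (⊤)
open import Relation.Nullary using (¬_)
open import Relation.Binary.PropositionalEquality using (_≡_; _≢_)
open import Relation.Binary.Structures using (IsTotalOrder)
open import Algebra.Structures using (IsCommutativeRing)

-- An ordered field (the paper works over ℝ, which is an instance;
-- stdlib has no real numbers).  Equality is propositional.
record OrderedField : Set₁ where
  infixl 7 _*_
  infixl 6 _+_
  infix  4 _≤_
  field
    Carrier : Set
    _+_ _*_ : Carrier → Carrier → Carrier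
    -_      : Carrier → Carrier
    0# 1#   : Carrier
    _≤_     : Carrier → Carrier → Set
    isCommutativeRing : IsCommutativeRing _≡_ _+_ _*_ -_ 0# 1#
    isTotalOrder      : IsTotalOrder _≡_ _≤_
    0≢1     : 0# ≢ 1#
    inverse : ∀ x → x ≢ 0# → Σ Carrier (λ y → x * y ≡ 1#)
    +-mono-≤ : ∀ {a b} c → a ≤ b → a + c ≤ b + c
    *-nonneg : ∀ {a b} → 0# ≤ a → 0# ≤ b → 0# ≤ a * b

  infix 4 _<_
  _<_ : Carrier → Carrier → Set
  x < y = x ≤ y × x ≢ y

next : ∀ {n} → Fin n → Fin n
next {suc m} i = suc (toℕ i) mod suc m

iterNext : ∀ {n} → ℕ → Fin n → Fin n
iterNext zero    p = p
iterNext (suc k) p = iterNext k (next p)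

dist : ∀ {n} → Fin n → Fin n → ℕ
dist {suc m} p q = (suc m ℕ.+ toℕ q ∸ toℕ p) % suc m

module _ (F : OrderedField) where
  open OrderedField F

  Matrix : ℕ → Set
  Matrix n = Fin n → Fin n → Carrier

  Positive : Carrier → Set
  Positive x = 0# < x

  -- reciprocal: positive entries and a_ji = 1 / a_ij  (i.e. a_ji * a_ij = 1)
  Reciprocal : ∀ {n} → Matrix n → Set
  Reciprocal A = (∀ i j → Positive (A i j)) × (∀ i j → A j i * A i j ≡ 1#)

  Consistent : ∀ {n} → Matrix n → Set
  Consistent A = ∀ i j k → A i j * A j k ≡ A i k

  PC⁰ : ∀ {n} → Matrix n → Set
  PC⁰ A = Reciprocal A × ¬ Consistent A

  -- A Hamiltonian cycle τ is given by a listing σ : positions → vertices,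
  -- τ_{k+1} = σ k (positions 0..n-1, cyclically).
  -- walk A σ k p = product of the k consecutive cycle entries starting at position p:
  --   a_{σ p, σ (p+1)} * ... * a_{σ (p+k-1), σ (p+k)}
  walk : ∀ {n} → Matrix n → Permutation′ n → ℕ → Fin n → Carrier
  walk A σ zero    p = 1#
  walk A σ (suc k) p = A (σ ⟨$⟩ʳ p) (σ ⟨$⟩ʳ next p) * walk A σ k (next p)

  cycleValue : ∀ {n} → Matrix n → Permutation′ n → Carrier
  cycleValue {zero}  A σ = 1#
  cycleValue {suc m} A σ = walk A σ (suc m) fzero

  InΓ : ∀ {n} → Matrix n → Permutation′ n → Set
  InΓ A σ = cycleValue A σ < 1#

  P : ∀ {n} → Matrix n → Permutation′ n → Fin n → Fin n → Carrier
  P A σ i j = walk A σ (dist (σ ⟨$⟩ˡ i) (σ ⟨$⟩ˡ j)) (σ ⟨$⟩ˡ i)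

  -- w ∈ ℰ_τ(A), with the listing τ_1 = σ 0, ..., τ_n = σ (n-1):
  -- w positive and P(τ1,τ_{k+1}) w_{τ_{k+1}} ≥ P(τ1,τ_{k+2}) w_{τ_{k+2}} for k < n-1,
  -- and P(τ1,τ_n) w_{τ_n} ≥ τ(A) w_{τ1}  (the case k = n-1).
  ℰ : ∀ {n} → Matrix n → Permutation′ n → (Fin n → Carrier) → Set
  ℰ {zero}  A σ w = ⊤
  ℰ {suc m} A σ w =
    (∀ i → Positive (w i)) ×
    (∀ k → k ℕ.< suc m →
      walk A σ (suc k) fzero * w (σ ⟨$⟩ʳ iterNext (suc k) fzero)
        ≤ walk A σ k fzero * w (σ ⟨$⟩ʳ iterNext k fzero))

-- Let a, b be the positions of i, j on τ, W k the product of the first k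
-- entries along τ, and v k = W k · w (τ_{k+1}).  Membership w ∈ ℰ_τ(A) says
-- v 0 ≥ v 1 ≥ … ≥ v n = τ(A) · v 0, and the periodic extension
-- v (n + k) = τ(A) · v k is then decreasing on all of ℕ.  Walking from a to b
-- along τ ends at index a + d with W a · P(i,j) · w j = v (a + d) and
-- W a · w i = v a, so P(i,j) ≥ 1 gives w j ≤ P(i,j) · w j ≤ w i.  Conversely,
-- the vector with v = 1 on 0 … b and v = τ(A) afterwards lies in ℰ_τ(A) since
-- τ(A) ≤ 1, and has v (a + d) = v a; for it w j ≤ w i becomes v a ≤ P(i,j) · v a.
module Submission where

open import Defs
open import Data.Nat as ℕ using (ℕ; zero; suc; _∸_; z≤n; s≤s)
import Data.Nat.Properties as ℕ
open import Data.Nat.DivMod using (_%_; m<n⇒m%n≡m; n%n≡0; [m+n]%n≡m%n)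
open import Data.Nat.Induction using (<-rec)
open import Data.Fin using (Fin; toℕ) renaming (zero to fzero)
open import Data.Fin.Properties using (toℕ-fromℕ<; toℕ-injective; toℕ<n)
open import Data.Fin.Permutation using (Permutation′; _⟨$⟩ʳ_; _⟨$⟩ˡ_; inverseʳ; inverseˡ)
open import Data.Product using (_,_; proj₁; proj₂)
open import Data.Sum using (inj₁; inj₂)
open import Function.Bundles using (_⇔_; mk⇔)
open import Relation.Nullary using (yes; no; contradiction)
open import Relation.Binary.PropositionalEquality
open import Relation.Binary.Bundles using (Poset)
open import Relation.Binary.Structures using (IsTotalOrder)
open import Algebra.Bundles using (CommutativeRing)
import Algebra.Properties.Ring as RingProperties
import Relation.Binary.Reasoning.PartialOrder as PartialOrderReasoning

module OrderedFieldProperties (F : OrderedField) where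
  open OrderedField F

  commutativeRing : CommutativeRing _ _
  commutativeRing = record { isCommutativeRing = isCommutativeRing }

  open CommutativeRing commutativeRing public
    using (*-assoc; *-comm; *-identityˡ; *-identityʳ; zeroʳ; distribˡ;
           +-identityˡ; +-identityʳ; -‿inverseˡ; -‿inverseʳ; +-assoc)
  open RingProperties (CommutativeRing.ring commutativeRing)
    using (-‿distribˡ-*; -‿distribʳ-*; -‿involutive)
  open IsTotalOrder isTotalOrder public
    using (total; antisym) renaming (refl to ≤-refl; reflexive to ≤-reflexive; trans to ≤-trans)

  ≤-poset : Poset _ _ _
  ≤-poset = record { isPartialOrder = IsTotalOrder.isPartialOrder isTotalOrder }

  module ≤-Reasoning = PartialOrderReasoning ≤-poset

  x≤y⇒0≤y-x : ∀ {x y} → x ≤ y → 0# ≤ y + - x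
  x≤y⇒0≤y-x {x} {y} x≤y = subst (_≤ y + - x) (-‿inverseʳ x) (+-mono-≤ (- x) x≤y)

  x≤0⇒0≤-x : ∀ {x} → x ≤ 0# → 0# ≤ - x
  x≤0⇒0≤-x {x} x≤0 = subst (0# ≤_) (+-identityˡ (- x)) (x≤y⇒0≤y-x x≤0)

  *-monoˡ-≤-nonNeg : ∀ {a b c} → 0# ≤ c → a ≤ b → c * a ≤ c * b
  *-monoˡ-≤-nonNeg {a} {b} {c} 0≤c a≤b = begin
    c * a                     ≡⟨ +-identityˡ (c * a) ⟨
    0# + c * a                ≤⟨ +-mono-≤ (c * a) (*-nonneg 0≤c (x≤y⇒0≤y-x a≤b)) ⟩
    c * (b + - a) + c * a     ≡⟨ cong (_+ c * a) (distribˡ c b (- a)) ⟩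
    c * b + c * - a + c * a   ≡⟨ cong (λ t → c * b + t + c * a) (-‿distribʳ-* c a) ⟨
    c * b + - (c * a) + c * a ≡⟨ +-assoc (c * b) (- (c * a)) (c * a) ⟩
    c * b + (- (c * a) + c * a) ≡⟨ cong (c * b +_) (-‿inverseˡ (c * a)) ⟩
    c * b + 0#                ≡⟨ +-identityʳ (c * b) ⟩
    c * b                     ∎
    where open ≤-Reasoning

  0≤1 : 0# ≤ 1#
  0≤1 with total 0# 1#
  ... | inj₁ holds = holds
  ... | inj₂ 1≤0 = subst (0# ≤_) -1*-1≡1 (*-nonneg 0≤-1 0≤-1)
    where
    0≤-1 : 0# ≤ - 1#
    0≤-1 = x≤0⇒0≤-x 1≤0
    -1*-1≡1 : - 1# * - 1# ≡ 1#
    -1*-1≡1 = begin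
      - 1# * - 1#    ≡⟨ -‿distribˡ-* 1# (- 1#) ⟨
      - (1# * - 1#)  ≡⟨ cong -_ (*-identityˡ (- 1#)) ⟩
      - - 1#         ≡⟨ -‿involutive 1# ⟩
      1#             ∎
      where open ≡-Reasoning

  0<1 : 0# < 1#
  0<1 = 0≤1 , 0≢1

  pos⇒≢0 : ∀ {x} → 0# < x → x ≢ 0#
  pos⇒≢0 (_ , 0≢x) x≡0 = 0≢x (sym x≡0)

  inv⁺ : ∀ {x} → 0# < x → Carrier
  inv⁺ {x} 0<x = proj₁ (inverse x (pos⇒≢0 0<x))

  *-inv⁺ : ∀ {x} (0<x : 0# < x) → x * inv⁺ 0<x ≡ 1#
  *-inv⁺ {x} 0<x = proj₂ (inverse x (pos⇒≢0 0<x))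

  *-cancel-inverse : ∀ {x y} a → x * y ≡ 1# → x * (y * a) ≡ a
  *-cancel-inverse {x} {y} a xy≡1 = begin
    x * (y * a)  ≡⟨ *-assoc x y a ⟨
    x * y * a    ≡⟨ cong (_* a) xy≡1 ⟩
    1# * a       ≡⟨ *-identityˡ a ⟩
    a            ∎
    where open ≡-Reasoning

  inv⁺-cancelˡ : ∀ {c} (0<c : 0# < c) a → inv⁺ 0<c * (c * a) ≡ a
  inv⁺-cancelˡ {c} 0<c a = *-cancel-inverse a (trans (*-comm (inv⁺ 0<c) c) (*-inv⁺ 0<c))

  *-inv⁺-cancelˡ : ∀ {c} (0<c : 0# < c) a → c * (inv⁺ 0<c * a) ≡ a
  *-inv⁺-cancelˡ 0<c a = *-cancel-inverse a (*-inv⁺ 0<c)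

  inv⁺-pos : ∀ {x} (0<x : 0# < x) → 0# < inv⁺ 0<x
  inv⁺-pos {x} 0<x@(0≤x , _) with total 0# (inv⁺ 0<x)
  ... | inj₁ 0≤y = 0≤y , λ 0≡y → 0≢1 (trans (sym (zeroʳ x)) (trans (cong (x *_) 0≡y) (*-inv⁺ 0<x)))
  ... | inj₂ y≤0 = contradiction (antisym 0≤1 1≤0) 0≢1
    where
    y = inv⁺ 0<x
    0≤-1 : 0# ≤ - 1#
    0≤-1 = subst (0# ≤_) (trans (sym (-‿distribʳ-* x y)) (cong -_ (*-inv⁺ 0<x)))
                 (*-nonneg 0≤x (x≤0⇒0≤-x y≤0))
    1≤0 : 1# ≤ 0#
    1≤0 = subst₂ _≤_ (+-identityˡ 1#) (-‿inverseˡ 1#) (+-mono-≤ 1# 0≤-1)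

  *-pos : ∀ {a b} → 0# < a → 0# < b → 0# < a * b
  *-pos {a} {b} 0<a@(0≤a , _) 0<b@(0≤b , _) = *-nonneg 0≤a 0≤b , λ 0≡ab → pos⇒≢0 0<b (begin
    b                  ≡⟨ inv⁺-cancelˡ 0<a b ⟨
    inv⁺ 0<a * (a * b) ≡⟨ cong (inv⁺ 0<a *_) 0≡ab ⟨
    inv⁺ 0<a * 0#      ≡⟨ zeroʳ (inv⁺ 0<a) ⟩
    0#                 ∎)
    where open ≡-Reasoning

  *-cancelˡ-≤-pos : ∀ {a b c} → 0# < c → c * a ≤ c * b → a ≤ b
  *-cancelˡ-≤-pos {a} {b} {c} 0<c ca≤cb = begin
    a                  ≡⟨ inv⁺-cancelˡ 0<c a ⟨
    inv⁺ 0<c * (c * a) ≤⟨ *-monoˡ-≤-nonNeg (proj₁ (inv⁺-pos 0<c)) ca≤cb ⟩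
    inv⁺ 0<c * (c * b) ≡⟨ inv⁺-cancelˡ 0<c b ⟩
    b                  ∎
    where open ≤-Reasoning

  antitone-from-step : (v : ℕ → Carrier) → (∀ k → v (suc k) ≤ v k) →
                       ∀ {k l} → k ℕ.≤ l → v l ≤ v k
  antitone-from-step v step k≤l = go (ℕ.≤⇒≤′ k≤l)
    where
    go : ∀ {k l} → k ℕ.≤′ l → v l ≤ v k
    go ℕ.≤′-refl        = ≤-refl
    go (ℕ.≤′-step k≤′l) = ≤-trans (step _) (go k≤′l)

  step-≤-periodic : ∀ {c} m (v : ℕ → Carrier) → 0# ≤ c →
                    (∀ k → v (suc m ℕ.+ k) ≡ c * v k) →
                    (∀ k → k ℕ.< suc m → v (suc k) ≤ v k) →
                    ∀ k → v (suc k) ≤ v k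
  step-≤-periodic {c} m v 0≤c period initial = <-rec _ step
    where
    step : ∀ k → (∀ {j} → j ℕ.< k → v (suc j) ≤ v j) → v (suc k) ≤ v k
    step k rec with k ℕ.<? suc m
    ... | yes k<n = initial k k<n
    ... | no k≮n with r , refl ← ℕ.m≤n⇒∃[o]m+o≡n (ℕ.≮⇒≥ k≮n) = begin
      v (suc (suc m ℕ.+ r)) ≡⟨ cong v (ℕ.+-suc (suc m) r) ⟨
      v (suc m ℕ.+ suc r)   ≡⟨ period (suc r) ⟩
      c * v (suc r)         ≤⟨ *-monoˡ-≤-nonNeg 0≤c (rec (ℕ.m<n+m r (s≤s z≤n))) ⟩
      c * v r               ≡⟨ period r ⟨
      v (suc m ℕ.+ r)       ∎
      where open ≤-Reasoning

iterNext-+ : ∀ {n} k l (p : Fin n) → iterNext (k ℕ.+ l) p ≡ iterNext l (iterNext k p)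
iterNext-+ zero    l p = refl
iterNext-+ (suc k) l p = iterNext-+ k l (next p)

iterNext-suc : ∀ {n} k (p : Fin n) → iterNext (suc k) p ≡ next (iterNext k p)
iterNext-suc zero    p = refl
iterNext-suc (suc k) p = iterNext-suc k (next p)

toℕ-iterNext-suc : ∀ {m} k → k ℕ.< suc m →
                   toℕ (iterNext (suc k) (fzero {m})) ≡ suc k % suc m
toℕ-iterNext-suc {m} zero    _   = toℕ-fromℕ< _
toℕ-iterNext-suc {m} (suc k) k<n = begin
  toℕ (iterNext (suc (suc k)) fzero)      ≡⟨ cong toℕ (iterNext-suc (suc k) fzero) ⟩
  toℕ (next (iterNext (suc k) fzero))     ≡⟨ toℕ-fromℕ< _ ⟩
  suc (toℕ (iterNext (suc k) fzero)) % suc m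
    ≡⟨ cong (λ t → suc t % suc m) (toℕ-iterNext-suc k k<n′) ⟩
  suc (suc k % suc m) % suc m             ≡⟨ cong (λ t → suc t % suc m) (m<n⇒m%n≡m k<n) ⟩
  suc (suc k) % suc m                     ∎
  where
  open ≡-Reasoning
  k<n′ : k ℕ.< suc m
  k<n′ = ℕ.<-trans (ℕ.n<1+n k) k<n

toℕ-iterNext-fzero : ∀ {m} k → k ℕ.< suc m → toℕ (iterNext k (fzero {m})) ≡ k
toℕ-iterNext-fzero zero    _   = refl
toℕ-iterNext-fzero (suc k) k<n =
  trans (toℕ-iterNext-suc k (ℕ.<-trans (ℕ.n<1+n k) k<n)) (m<n⇒m%n≡m k<n)

iterNext-toℕ : ∀ {m} (p : Fin (suc m)) → iterNext (toℕ p) fzero ≡ p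
iterNext-toℕ p = toℕ-injective (toℕ-iterNext-fzero (toℕ p) (toℕ<n p))

iterNext-period : ∀ {m} → iterNext (suc m) (fzero {m}) ≡ fzero
iterNext-period {m} = toℕ-injective (trans (toℕ-iterNext-suc m (ℕ.n<1+n m)) (n%n≡0 (suc m)))

toℕ+dist≡toℕ : ∀ {m} (p q : Fin (suc m)) → toℕ p ℕ.≤ toℕ q →
               toℕ p ℕ.+ dist p q ≡ toℕ q
toℕ+dist≡toℕ {m} p q a≤b = trans (cong (a ℕ.+_) dist≡b∸a) (ℕ.m+[n∸m]≡n a≤b)
  where
  open ≡-Reasoning
  a = toℕ p
  b = toℕ q
  dist≡b∸a : dist p q ≡ b ∸ a
  dist≡b∸a = begin
    (suc m ℕ.+ b ∸ a) % suc m   ≡⟨ cong (_% suc m) (ℕ.+-∸-assoc (suc m) a≤b) ⟩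
    (suc m ℕ.+ (b ∸ a)) % suc m ≡⟨ cong (_% suc m) (ℕ.+-comm (suc m) (b ∸ a)) ⟩
    (b ∸ a ℕ.+ suc m) % suc m   ≡⟨ [m+n]%n≡m%n (b ∸ a) (suc m) ⟩
    (b ∸ a) % suc m             ≡⟨ m<n⇒m%n≡m (ℕ.≤-<-trans (ℕ.m∸n≤m b a) (toℕ<n q)) ⟩
    b ∸ a                       ∎

toℕ+dist≡n+toℕ : ∀ {m} (p q : Fin (suc m)) → toℕ q ℕ.< toℕ p →
                 toℕ p ℕ.+ dist p q ≡ suc m ℕ.+ toℕ q
toℕ+dist≡n+toℕ {m} p q b<a =
  trans (cong (a ℕ.+_) (m<n⇒m%n≡m n+b∸a<n)) (ℕ.m+[n∸m]≡n a≤n+b)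
  where
  a = toℕ p
  b = toℕ q
  a≤n+b : a ℕ.≤ suc m ℕ.+ b
  a≤n+b = ℕ.≤-trans (ℕ.<⇒≤ (toℕ<n p)) (ℕ.m≤m+n (suc m) b)
  n+b∸a<n : suc m ℕ.+ b ∸ a ℕ.< suc m
  n+b∸a<n = subst (suc m ℕ.+ b ∸ a ℕ.<_) (ℕ.m+n∸n≡m (suc m) a)
                  (ℕ.∸-monoˡ-< (ℕ.+-monoʳ-< (suc m) b<a) a≤n+b)

iterNext-n+ : ∀ {m} k → iterNext (suc m ℕ.+ k) (fzero {m}) ≡ iterNext k fzero
iterNext-n+ {m} k = trans (iterNext-+ (suc m) k fzero) (cong (iterNext k) iterNext-period)

iterNext-toℕ+dist : ∀ {m} (p q : Fin (suc m)) → iterNext (toℕ p ℕ.+ dist p q) fzero ≡ q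
iterNext-toℕ+dist {m} p q with ℕ.≤-<-connex (toℕ p) (toℕ q)
... | inj₁ a≤b = trans (cong (λ k → iterNext k fzero) (toℕ+dist≡toℕ p q a≤b)) (iterNext-toℕ q)
... | inj₂ b<a = begin
  iterNext (toℕ p ℕ.+ dist p q) fzero ≡⟨ cong (λ k → iterNext k fzero) (toℕ+dist≡n+toℕ p q b<a) ⟩
  iterNext (suc m ℕ.+ toℕ q) fzero    ≡⟨ iterNext-n+ (toℕ q) ⟩
  iterNext (toℕ q) fzero              ≡⟨ iterNext-toℕ q ⟩
  q                                   ∎
  where open ≡-Reasoning

module Profile (F : OrderedField) {m : ℕ} (A : Matrix F (suc m))
               (A-pos : ∀ i j → Positive F (A i j)) (σ : Permutation′ (suc m)) where
  open OrderedField F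
  open OrderedFieldProperties F

  walk-+ : ∀ k l p → walk F A σ (k ℕ.+ l) p ≡ walk F A σ k p * walk F A σ l (iterNext k p)
  walk-+ zero    l p = sym (*-identityˡ _)
  walk-+ (suc k) l p = trans (cong (A (σ ⟨$⟩ʳ p) (σ ⟨$⟩ʳ next p) *_) (walk-+ k l (next p)))
                             (sym (*-assoc _ _ _))

  walk-pos : ∀ k p → 0# < walk F A σ k p
  walk-pos zero    p = 0<1
  walk-pos (suc k) p = *-pos (A-pos _ _) (walk-pos k (next p))

  prefix : ℕ → Carrier
  prefix k = walk F A σ k fzero

  τ : Carrier
  τ = cycleValue F A σ

  position : Fin (suc m) → ℕ
  position i = toℕ (σ ⟨$⟩ˡ i)

  offset : Fin (suc m) → Fin (suc m) → ℕ
  offset i j = dist (σ ⟨$⟩ˡ i) (σ ⟨$⟩ˡ j)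

  -- The sequence v; ℰ F A σ w unfolds to profile w (suc k) ≤ profile w k for k < n.
  profile : (Fin (suc m) → Carrier) → ℕ → Carrier
  profile w k = prefix k * w (σ ⟨$⟩ʳ iterNext k fzero)

  profile-period : ∀ w k → profile w (suc m ℕ.+ k) ≡ τ * profile w k
  profile-period w k = begin
    prefix (suc m ℕ.+ k) * w (σ ⟨$⟩ʳ iterNext (suc m ℕ.+ k) fzero)
      ≡⟨ cong₂ _*_ (walk-+ (suc m) k fzero) (cong (λ p → w (σ ⟨$⟩ʳ p)) (iterNext-n+ k)) ⟩
    τ * walk F A σ k (iterNext (suc m) fzero) * w (σ ⟨$⟩ʳ iterNext k fzero)
      ≡⟨ cong (λ p → τ * walk F A σ k p * w (σ ⟨$⟩ʳ iterNext k fzero)) iterNext-period ⟩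
    τ * prefix k * w (σ ⟨$⟩ʳ iterNext k fzero)
      ≡⟨ *-assoc τ (prefix k) _ ⟩
    τ * profile w k ∎
    where open ≡-Reasoning

  profile-position : ∀ w i → profile w (position i) ≡ prefix (position i) * w i
  profile-position w i = trans
    (cong (λ p → prefix (position i) * w (σ ⟨$⟩ʳ p)) (iterNext-toℕ (σ ⟨$⟩ˡ i)))
    (cong (λ x → prefix (position i) * w x) (inverseʳ σ))

  profile-position+offset : ∀ w i j → profile w (position i ℕ.+ offset i j)
                                      ≡ prefix (position i) * (P F A σ i j * w j)
  profile-position+offset w i j = begin
    prefix (a ℕ.+ d) * w (σ ⟨$⟩ʳ iterNext (a ℕ.+ d) fzero)
      ≡⟨ cong₂ _*_ (walk-+ a d fzero)
                   (cong (λ p → w (σ ⟨$⟩ʳ p)) (iterNext-toℕ+dist (σ ⟨$⟩ˡ i) (σ ⟨$⟩ˡ j))) ⟩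
    prefix a * walk F A σ d (iterNext a fzero) * w (σ ⟨$⟩ʳ (σ ⟨$⟩ˡ j))
      ≡⟨ cong₂ (λ p x → prefix a * walk F A σ d p * w x) (iterNext-toℕ (σ ⟨$⟩ˡ i)) (inverseʳ σ) ⟩
    prefix a * P F A σ i j * w j
      ≡⟨ *-assoc (prefix a) _ (w j) ⟩
    prefix a * (P F A σ i j * w j) ∎
    where
    open ≡-Reasoning
    a = position i
    d = offset i j

  ℰ⇒profile-antitone : ∀ {w} → ℰ F A σ w → ∀ {k l} → k ℕ.≤ l → profile w l ≤ profile w k
  ℰ⇒profile-antitone {w} (_ , decreasing) =
    antitone-from-step (profile w)
      (step-≤-periodic m (profile w) (proj₁ (walk-pos (suc m) fzero)) (profile-period w) decreasing)

  ℰ∧P≥1⇒≤ : ∀ {w} → ℰ F A σ w → ∀ i j → 1# ≤ P F A σ i j → w j ≤ w i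
  ℰ∧P≥1⇒≤ {w} w∈ℰ@(w-pos , _) i j 1≤P = begin
    w j                   ≡⟨ *-identityʳ (w j) ⟨
    w j * 1#              ≤⟨ *-monoˡ-≤-nonNeg (proj₁ (w-pos j)) 1≤P ⟩
    w j * P F A σ i j     ≡⟨ *-comm (w j) _ ⟩
    P F A σ i j * w j     ≤⟨ *-cancelˡ-≤-pos (walk-pos a fzero) scaled ⟩
    w i                   ∎
    where
    open ≤-Reasoning
    a = position i
    scaled : prefix a * (P F A σ i j * w j) ≤ prefix a * w i
    scaled = begin
      prefix a * (P F A σ i j * w j) ≡⟨ profile-position+offset w i j ⟨
      profile w (a ℕ.+ offset i j)   ≤⟨ ℰ⇒profile-antitone w∈ℰ (ℕ.m≤m+n a (offset i j)) ⟩
      profile w a                    ≡⟨ profile-position w i ⟩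
      prefix a * w i                 ∎

  balanced⇒P≥1 : ∀ {w} i j → 0# < w i →
                 profile w (position i ℕ.+ offset i j) ≡ profile w (position i) →
                 w j ≤ w i → 1# ≤ P F A σ i j
  balanced⇒P≥1 {w} i j 0<wi balanced wj≤wi = *-cancelˡ-≤-pos (*-pos (walk-pos a fzero) 0<wi) (begin
    prefix a * w i * 1#              ≡⟨ *-identityʳ _ ⟩
    prefix a * w i                   ≡⟨ profile-position w i ⟨
    profile w a                      ≡⟨ balanced ⟨
    profile w (a ℕ.+ offset i j)     ≡⟨ profile-position+offset w i j ⟩
    prefix a * (P F A σ i j * w j)   ≤⟨ *-monoˡ-≤-nonNeg (proj₁ (walk-pos a fzero))
                                          (*-monoˡ-≤-nonNeg (proj₁ (walk-pos (offset i j) (σ ⟨$⟩ˡ i))) wj≤wi) ⟩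
    prefix a * (P F A σ i j * w i)   ≡⟨ cong (prefix a *_) (*-comm _ (w i)) ⟩
    prefix a * (w i * P F A σ i j)   ≡⟨ *-assoc (prefix a) (w i) _ ⟨
    prefix a * w i * P F A σ i j     ∎)
    where
    open ≤-Reasoning
    a = position i

  level : ℕ → ℕ → Carrier
  level b k with k ℕ.≤? b
  ... | yes _ = 1#
  ... | no  _ = τ

  level-≤ : ∀ {b k} → k ℕ.≤ b → level b k ≡ 1#
  level-≤ {b} {k} k≤b with k ℕ.≤? b
  ... | yes _   = refl
  ... | no  k≰b = contradiction k≤b k≰b

  level-> : ∀ {b k} → b ℕ.< k → level b k ≡ τ
  level-> {b} {k} b<k with k ℕ.≤? b
  ... | yes k≤b = contradiction k≤b (ℕ.<⇒≱ b<k)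
  ... | no  _   = refl

  level-pos : ∀ b k → 0# < level b k
  level-pos b k with k ℕ.≤? b
  ... | yes _ = 0<1
  ... | no  _ = walk-pos (suc m) fzero

  τ≤level : τ ≤ 1# → ∀ b k → τ ≤ level b k
  τ≤level τ≤1 b k with k ℕ.≤? b
  ... | yes _ = τ≤1
  ... | no  _ = ≤-refl

  level-step : τ ≤ 1# → ∀ b k → level b (suc k) ≤ level b k
  level-step τ≤1 b k with suc k ℕ.≤? b
  ... | yes k<b = ≤-reflexive (sym (level-≤ (ℕ.<⇒≤ k<b)))
  ... | no  _   = τ≤level τ≤1 b k

  testVector : ℕ → Fin (suc m) → Carrier
  testVector b x = inv⁺ (walk-pos (position x) fzero) * level b (position x)

  profile-testVector : ∀ b {k} → k ℕ.< suc m → profile (testVector b) k ≡ level b k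
  profile-testVector b {k} k<n = begin
    prefix k * testVector b (σ ⟨$⟩ʳ iterNext k fzero)
      ≡⟨ cong (λ t → prefix k * (inv⁺ (walk-pos t fzero) * level b t)) position≡k ⟩
    prefix k * (inv⁺ (walk-pos k fzero) * level b k)
      ≡⟨ *-inv⁺-cancelˡ (walk-pos k fzero) (level b k) ⟩
    level b k ∎
    where
    open ≡-Reasoning
    position≡k : position (σ ⟨$⟩ʳ iterNext k fzero) ≡ k
    position≡k = trans (cong toℕ (inverseˡ σ)) (toℕ-iterNext-fzero k k<n)

  testVector∈ℰ : τ ≤ 1# → ∀ b → ℰ F A σ (testVector b)
  testVector∈ℰ τ≤1 b = testVector-pos , decreasing
    where
    v = testVector b
    testVector-pos : ∀ x → 0# < v x
    testVector-pos x = *-pos (inv⁺-pos (walk-pos (position x) fzero)) (level-pos b (position x))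
    decreasing : ∀ k → k ℕ.< suc m → profile v (suc k) ≤ profile v k
    decreasing k k<n with ℕ.m≤n⇒m<n∨m≡n k<n
    ... | inj₁ k+1<n = subst₂ _≤_ (sym (profile-testVector b k+1<n)) (sym (profile-testVector b k<n))
                                 (level-step τ≤1 b k)
    ... | inj₂ refl  = begin
      profile v (suc m)           ≡⟨ cong (profile v) (ℕ.+-identityʳ (suc m)) ⟨
      profile v (suc m ℕ.+ 0)     ≡⟨ profile-period v 0 ⟩
      τ * profile v 0             ≡⟨ cong (τ *_) (trans (profile-testVector b (s≤s z≤n)) (level-≤ {b} z≤n)) ⟩
      τ * 1#                      ≡⟨ *-identityʳ τ ⟩
      τ                           ≤⟨ τ≤level τ≤1 b m ⟩
      level b m                   ≡⟨ profile-testVector b k<n ⟨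
      profile v m                 ∎
      where open ≤-Reasoning

  testVector-balanced : ∀ i j → let v = testVector (position j) in
                        profile v (position i ℕ.+ offset i j) ≡ profile v (position i)
  testVector-balanced i j with ℕ.≤-<-connex (position i) (position j)
  ... | inj₁ a≤b = begin
    profile v (a ℕ.+ offset i j)  ≡⟨ cong (profile v) (toℕ+dist≡toℕ (σ ⟨$⟩ˡ i) (σ ⟨$⟩ˡ j) a≤b) ⟩
    profile v b                   ≡⟨ profile-testVector b (toℕ<n (σ ⟨$⟩ˡ j)) ⟩
    level b b                     ≡⟨ level-≤ {b} ℕ.≤-refl ⟩
    1#                            ≡⟨ level-≤ a≤b ⟨
    level b a                     ≡⟨ profile-testVector b (toℕ<n (σ ⟨$⟩ˡ i)) ⟨
    profile v a                   ∎
    where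
    open ≡-Reasoning
    a = position i
    b = position j
    v = testVector b
  ... | inj₂ b<a = begin
    profile v (a ℕ.+ offset i j)  ≡⟨ cong (profile v) (toℕ+dist≡n+toℕ (σ ⟨$⟩ˡ i) (σ ⟨$⟩ˡ j) b<a) ⟩
    profile v (suc m ℕ.+ b)       ≡⟨ profile-period v b ⟩
    τ * profile v b               ≡⟨ cong (τ *_) (profile-testVector b (toℕ<n (σ ⟨$⟩ˡ j))) ⟩
    τ * level b b                 ≡⟨ cong (τ *_) (level-≤ {b} ℕ.≤-refl) ⟩
    τ * 1#                        ≡⟨ *-identityʳ τ ⟩
    τ                             ≡⟨ level-> b<a ⟨
    level b a                     ≡⟨ profile-testVector b (toℕ<n (σ ⟨$⟩ˡ i)) ⟨
    profile v a                   ∎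
    where
    open ≡-Reasoning
    a = position i
    b = position j
    v = testVector b

theorem6p4 : (F : OrderedField) (n : ℕ) → 3 ℕ.≤ n →
    (A : Matrix F n) → PC⁰ F A →
    (σ : Permutation′ n) → InΓ F A σ →
    (i j : Fin n) → i ≢ j →
    (OrderedField._≤_ F (OrderedField.1# F) (P F A σ i j)
    ⇔ (∀ (w : Fin n → OrderedField.Carrier F) → ℰ F A σ w → OrderedField._≤_ F (w j) (w i)))
theorem6p4 F zero    _ A _                  σ _         () j _
theorem6p4 F (suc m) _ A ((A-pos , _) , _) σ (τ≤1 , _) i  j _ =
  mk⇔ (λ 1≤P w w∈ℰ → ℰ∧P≥1⇒≤ w∈ℰ i j 1≤P)
      (λ ℰ⇒wj≤wi → balanced⇒P≥1 i j (proj₁ v∈ℰ i) (testVector-balanced i j) (ℰ⇒wj≤wi v v∈ℰ))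
  where
  open Profile F A A-pos σ
  v = testVector (position j)
  v∈ℰ : ℰ F A σ v
  v∈ℰ = testVector∈ℰ τ≤1 (position j)
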